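{- Let $u,w$ be words. If $u\equiv_i w$, then $u\sim_{rd}w$.
   Context: Words have positive integer letters. Two words are i-Knuth equivalent, $u\equiv_i w$, if one can be obtained from the other by finitely many moves of the forms $\cdots a\cdots\leftrightarrow\cdots aa\cdots$, $\cdots bca\cdots\leftrightarrow\cdots bac\cdots$ with $a<b\le c$, and $\cdots acb\cdots\leftrightarrow\cdots cab\cdots$ with $a\le b<c$. For a word $x$, $\mathrm{lds}(x)$ is the length of a longest strictly decreasing subsequence. $u\sim_{rd}w$ means that for every integer interval $[a,b]$, the words $u',w'$ obtained from $u,w$ by deleting all letters not in $[a,b]$ satisfy $\mathrm{lds}(u')=\mathrm{lds}(w')$. -}

module Defs where

open import Data.Nat using (ℕ; _≤_; _<_; _>_)
open import Data.Nat.Properties using (_≤?_)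

open import Data.List using (List; []; _∷_; _++_; [_]; length; filter)
open import Data.List.Relation.Unary.All using (All)
open import Data.List.Relation.Unary.Linked using (Linked)
open import Data.List.Relation.Binary.Sublist.Propositional using (_⊆_)
open import Data.Product using (Σ; _×_; ∃-syntax)
open import Data.Sum using (_⊎_)
open import Relation.Binary.PropositionalEquality using (_≡_)
open import Relation.Binary.Construct.Closure.ReflexiveTransitive using (Star)
open import Relation.Nullary.Decidable using (_×-dec_)

Word : Set
Word = List ℕ

Positive : Word → Set
Positive w = All (λ x → 1 ≤ x) w

data Basic : Word → Word → Set where
  idem  : ∀ {a}     → Basic (a ∷ []) (a ∷ a ∷ [])
  knuth1 : ∀ {a b c} → a < b → b ≤ c → Basic (b ∷ c ∷ a ∷ []) (b ∷ a ∷ c ∷ [])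
  knuth2 : ∀ {a b c} → a ≤ b → b < c → Basic (a ∷ c ∷ b ∷ []) (c ∷ a ∷ b ∷ [])

data Move : Word → Word → Set where
  move : ∀ p s {x y} → (Basic x y ⊎ Basic y x) → Move (p ++ x ++ s) (p ++ y ++ s)

_≡ᵢ_ : Word → Word → Set
u ≡ᵢ w = Star Move u w

StrictlyDecreasing : Word → Set
StrictlyDecreasing = Linked _>_

IsLDS : Word → ℕ → Set
IsLDS x n = (Σ Word λ v → v ⊆ x × StrictlyDecreasing v × length v ≡ n)
          × (∀ v → v ⊆ x → StrictlyDecreasing v → length v ≤ n)

restrict : ℕ → ℕ → Word → Word
restrict a b = filter (λ x → (a ≤? x) ×-dec (x ≤? b))

_∼rd_ : Word → Word → Set
u ∼rd w = ∀ a b n → (IsLDS (restrict a b u) n → IsLDS (restrict a b w) n)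
                  × (IsLDS (restrict a b w) n → IsLDS (restrict a b u) n)

-- An i-Knuth move rewrites a factor of at most three letters, which meets a
-- strictly decreasing subsequence v in at most two letters.  In every case this
-- piece of v can be replaced, inside the new word, by a strictly decreasing piece
-- at least as long whose letters lie in the convex hull of the old ones (in
-- bca → bac the piece ca becomes ba, as a < b ≤ c).  Staying in the convex hull
-- preserves the comparisons with the rest of v, and keeps all letters inside any
-- interval [a,b] that contained the old ones; so each move, and hence each
-- i-Knuth equivalence, can only increase the lds of every restriction.  Moves
-- are reversible, which gives equality.
module Submission where

open import Defs
open import Level using (0ℓ)
open import Function using (id; _∘_)
open import Data.Nat using (ℕ; _≤_; _<_; _>_)
open import Data.Nat.Properties
  using (≤-refl; ≤-trans; ≤-antisym; <⇒≤; <-trans; <-≤-trans; ≤-<-trans; ≤⇒≯; <-irrefl; +-mono-≤)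
open import Data.List using (List; []; _∷_; _++_; length; filter)
open import Data.List.Properties using (length-++; filter-all)
open import Data.List.Relation.Unary.All as All using (All; []; _∷_)
open import Data.List.Relation.Unary.All.Properties using (all-filter)
import Data.List.Relation.Unary.All.Properties as All
open import Data.List.Relation.Unary.AllPairs using (AllPairs; []; _∷_)
import Data.List.Relation.Unary.AllPairs.Properties as AllPairs
open import Data.List.Relation.Unary.Linked using ([]; [-]; _∷_)
open import Data.List.Relation.Unary.Linked.Properties using (AllPairs⇒Linked; Linked⇒AllPairs)
open import Data.List.Relation.Binary.Sublist.Propositional using (_⊆_; []; _∷_; _∷ʳ_; ⊆-trans)
open import Data.List.Relation.Binary.Sublist.Propositional.Properties
  using (filter-⊆; filter⁺; All-resp-⊆)
import Data.List.Relation.Binary.Sublist.Propositional.Properties as Sublist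
open import Data.Product using (_×_; _,_; ∃₂)
open import Data.Sum using (inj₁; inj₂)
open import Data.Empty using (⊥-elim)
open import Relation.Unary using (Pred; Decidable)
open import Relation.Binary using (Rel)
open import Relation.Binary.PropositionalEquality using (_≡_; refl; subst)
open import Relation.Binary.Construct.Closure.ReflexiveTransitive as Star using ()

Convex : Pred ℕ 0ℓ → Set
Convex P = ∀ {x y z} → x ≤ y → y ≤ z → P x → P z → P y

upward-closed⇒convex : ∀ {P} → (∀ {x y} → x ≤ y → P x → P y) → Convex P
upward-closed⇒convex up x≤y _ Px _ = up x≤y Px

downward-closed⇒convex : ∀ {P} → (∀ {x y} → x ≤ y → P y → P x) → Convex P
downward-closed⇒convex down _ y≤z _ Pz = down y≤z Pz

InInterval : ℕ → ℕ → Pred ℕ 0ℓ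
InInterval a b x = a ≤ x × x ≤ b

interval-convex : ∀ a b → Convex (InInterval a b)
interval-convex a b x≤y y≤z (a≤x , _) (_ , z≤b) = ≤-trans a≤x x≤y , ≤-trans y≤z z≤b

record Replacement (w v : Word) : Set₁ where
  field
    word        : Word
    sublist     : word ⊆ w
    decreasing  : StrictlyDecreasing word
    longer      : length v ≤ length word
    convex-hull : ∀ {P} → Convex P → All P v → All P word

open Replacement

_≼_ : Word → Word → Set₁
u ≼ w = ∀ {v} → v ⊆ u → StrictlyDecreasing v → Replacement w v

self-replacement : ∀ {v w} → v ⊆ w → StrictlyDecreasing v → Replacement w v
self-replacement v⊆w dec = record
  { word = _ ; sublist = v⊆w ; decreasing = dec ; longer = ≤-refl ; convex-hull = λ _ → id }

≼-refl : ∀ {u} → u ≼ u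
≼-refl = self-replacement

≼-trans : ∀ {u v w} → u ≼ v → v ≼ w → u ≼ w
≼-trans {v = v} {w} u≼v v≼w {x} x⊆u dec = record
  { word        = word r′
  ; sublist     = sublist r′
  ; decreasing  = decreasing r′
  ; longer      = ≤-trans (longer r) (longer r′)
  ; convex-hull = λ convex → convex-hull r′ convex ∘ convex-hull r convex
  }
  where
    r : Replacement v x
    r = u≼v x⊆u dec
    r′ : Replacement w (word r)
    r′ = v≼w (sublist r) (decreasing r)

a≼aa : ∀ {a} → (a ∷ []) ≼ (a ∷ a ∷ [])
a≼aa (_ ∷ʳ [])  d = self-replacement (_ ∷ʳ _ ∷ʳ []) d
a≼aa (refl ∷ []) d = self-replacement (refl ∷ _ ∷ʳ []) d

aa≼a : ∀ {a} → (a ∷ a ∷ []) ≼ (a ∷ [])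
aa≼a (_ ∷ʳ _ ∷ʳ [])     d = self-replacement (_ ∷ʳ []) d
aa≼a (_ ∷ʳ refl ∷ [])   d = self-replacement (refl ∷ []) d
aa≼a (refl ∷ _ ∷ʳ [])   d = self-replacement (refl ∷ []) d
aa≼a (refl ∷ refl ∷ []) (a>a ∷ _) = ⊥-elim (<-irrefl refl a>a)

bca≼bac : ∀ {a b c} → a < b → b ≤ c → (b ∷ c ∷ a ∷ []) ≼ (b ∷ a ∷ c ∷ [])
bca≼bac a<b b≤c (_ ∷ʳ _ ∷ʳ _ ∷ʳ [])       d = self-replacement (_ ∷ʳ _ ∷ʳ _ ∷ʳ []) d
bca≼bac a<b b≤c (_ ∷ʳ _ ∷ʳ refl ∷ [])     d = self-replacement (_ ∷ʳ refl ∷ _ ∷ʳ []) d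
bca≼bac a<b b≤c (_ ∷ʳ refl ∷ _ ∷ʳ [])     d = self-replacement (_ ∷ʳ _ ∷ʳ refl ∷ []) d
bca≼bac a<b b≤c (_ ∷ʳ refl ∷ refl ∷ [])   _ = record
  { word = _ ∷ _ ∷ [] ; sublist = refl ∷ refl ∷ _ ∷ʳ [] ; decreasing = a<b ∷ [-]
  ; longer = ≤-refl
  ; convex-hull = λ { convex (Pc ∷ Pa ∷ []) → convex (<⇒≤ a<b) b≤c Pa Pc ∷ Pa ∷ [] }
  }
bca≼bac a<b b≤c (refl ∷ _ ∷ʳ _ ∷ʳ [])     d = self-replacement (refl ∷ _ ∷ʳ _ ∷ʳ []) d
bca≼bac a<b b≤c (refl ∷ _ ∷ʳ refl ∷ [])   d = self-replacement (refl ∷ refl ∷ _ ∷ʳ []) d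
bca≼bac a<b b≤c (refl ∷ refl ∷ _ ∷ʳ [])   (c<b ∷ _) = ⊥-elim (≤⇒≯ b≤c c<b)
bca≼bac a<b b≤c (refl ∷ refl ∷ refl ∷ []) (c<b ∷ _) = ⊥-elim (≤⇒≯ b≤c c<b)

bac≼bca : ∀ {a b c} → a < b → b ≤ c → (b ∷ a ∷ c ∷ []) ≼ (b ∷ c ∷ a ∷ [])
bac≼bca a<b b≤c (_ ∷ʳ _ ∷ʳ _ ∷ʳ [])       d = self-replacement (_ ∷ʳ _ ∷ʳ _ ∷ʳ []) d
bac≼bca a<b b≤c (_ ∷ʳ _ ∷ʳ refl ∷ [])     d = self-replacement (_ ∷ʳ refl ∷ _ ∷ʳ []) d
bac≼bca a<b b≤c (_ ∷ʳ refl ∷ _ ∷ʳ [])     d = self-replacement (_ ∷ʳ _ ∷ʳ refl ∷ []) d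
bac≼bca a<b b≤c (_ ∷ʳ refl ∷ refl ∷ [])   (c<a ∷ _) = ⊥-elim (≤⇒≯ (≤-trans (<⇒≤ a<b) b≤c) c<a)
bac≼bca a<b b≤c (refl ∷ _ ∷ʳ _ ∷ʳ [])     d = self-replacement (refl ∷ _ ∷ʳ _ ∷ʳ []) d
bac≼bca a<b b≤c (refl ∷ _ ∷ʳ refl ∷ [])   (c<b ∷ _) = ⊥-elim (≤⇒≯ b≤c c<b)
bac≼bca a<b b≤c (refl ∷ refl ∷ _ ∷ʳ [])   d = self-replacement (refl ∷ _ ∷ʳ refl ∷ []) d
bac≼bca a<b b≤c (refl ∷ refl ∷ refl ∷ []) (_ ∷ c<a ∷ _) = ⊥-elim (≤⇒≯ (≤-trans (<⇒≤ a<b) b≤c) c<a)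

acb≼cab : ∀ {a b c} → a ≤ b → b < c → (a ∷ c ∷ b ∷ []) ≼ (c ∷ a ∷ b ∷ [])
acb≼cab a≤b b<c (_ ∷ʳ _ ∷ʳ _ ∷ʳ [])       d = self-replacement (_ ∷ʳ _ ∷ʳ _ ∷ʳ []) d
acb≼cab a≤b b<c (_ ∷ʳ _ ∷ʳ refl ∷ [])     d = self-replacement (_ ∷ʳ _ ∷ʳ refl ∷ []) d
acb≼cab a≤b b<c (_ ∷ʳ refl ∷ _ ∷ʳ [])     d = self-replacement (refl ∷ _ ∷ʳ _ ∷ʳ []) d
acb≼cab a≤b b<c (_ ∷ʳ refl ∷ refl ∷ [])   d = self-replacement (refl ∷ _ ∷ʳ refl ∷ []) d
acb≼cab a≤b b<c (refl ∷ _ ∷ʳ _ ∷ʳ [])     d = self-replacement (_ ∷ʳ refl ∷ _ ∷ʳ []) d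
acb≼cab a≤b b<c (refl ∷ _ ∷ʳ refl ∷ [])   (b<a ∷ _) = ⊥-elim (≤⇒≯ a≤b b<a)
acb≼cab a≤b b<c (refl ∷ refl ∷ _ ∷ʳ [])   (c<a ∷ _) = ⊥-elim (≤⇒≯ (≤-trans a≤b (<⇒≤ b<c)) c<a)
acb≼cab a≤b b<c (refl ∷ refl ∷ refl ∷ []) (c<a ∷ _) = ⊥-elim (≤⇒≯ (≤-trans a≤b (<⇒≤ b<c)) c<a)

cab≼acb : ∀ {a b c} → a ≤ b → b < c → (c ∷ a ∷ b ∷ []) ≼ (a ∷ c ∷ b ∷ [])
cab≼acb a≤b b<c (_ ∷ʳ _ ∷ʳ _ ∷ʳ [])       d = self-replacement (_ ∷ʳ _ ∷ʳ _ ∷ʳ []) d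
cab≼acb a≤b b<c (_ ∷ʳ _ ∷ʳ refl ∷ [])     d = self-replacement (_ ∷ʳ _ ∷ʳ refl ∷ []) d
cab≼acb a≤b b<c (_ ∷ʳ refl ∷ _ ∷ʳ [])     d = self-replacement (refl ∷ _ ∷ʳ _ ∷ʳ []) d
cab≼acb a≤b b<c (_ ∷ʳ refl ∷ refl ∷ [])   (b<a ∷ _) = ⊥-elim (≤⇒≯ a≤b b<a)
cab≼acb a≤b b<c (refl ∷ _ ∷ʳ _ ∷ʳ [])     d = self-replacement (_ ∷ʳ refl ∷ _ ∷ʳ []) d
cab≼acb a≤b b<c (refl ∷ _ ∷ʳ refl ∷ [])   d = self-replacement (_ ∷ʳ refl ∷ refl ∷ []) d
cab≼acb a≤b b<c (refl ∷ refl ∷ _ ∷ʳ [])   _ = record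
  { word = _ ∷ _ ∷ [] ; sublist = _ ∷ʳ refl ∷ refl ∷ [] ; decreasing = b<c ∷ [-]
  ; longer = ≤-refl
  ; convex-hull = λ { convex (Pc ∷ Pa ∷ []) → Pc ∷ convex a≤b (<⇒≤ b<c) Pa Pc ∷ [] }
  }
cab≼acb a≤b b<c (refl ∷ refl ∷ refl ∷ []) (_ ∷ b<a ∷ _) = ⊥-elim (≤⇒≯ a≤b b<a)

Basic⇒≼ : ∀ {x y} → Basic x y → x ≼ y
Basic⇒≼ idem               = a≼aa
Basic⇒≼ (knuth1 a<b b≤c)   = bca≼bac a<b b≤c
Basic⇒≼ (knuth2 a≤b b<c)   = acb≼cab a≤b b<c

Basic⇒≽ : ∀ {x y} → Basic x y → y ≼ x
Basic⇒≽ idem               = aa≼a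
Basic⇒≽ (knuth1 a<b b≤c)   = bac≼bca a<b b≤c
Basic⇒≽ (knuth2 a≤b b<c)   = cab≼acb a≤b b<c

⊆-++⁻ : ∀ {A : Set} (xs : List A) {ys v} → v ⊆ xs ++ ys →
        ∃₂ λ v₁ v₂ → v ≡ v₁ ++ v₂ × v₁ ⊆ xs × v₂ ⊆ ys
⊆-++⁻ []       v⊆ys = [] , _ , refl , [] , v⊆ys
⊆-++⁻ (x ∷ xs) (.x ∷ʳ v⊆) with ⊆-++⁻ xs v⊆
... | v₁ , v₂ , refl , v₁⊆xs , v₂⊆ys = v₁ , v₂ , refl , x ∷ʳ v₁⊆xs , v₂⊆ys
⊆-++⁻ (x ∷ xs) (refl ∷ v⊆) with ⊆-++⁻ xs v⊆
... | v₁ , v₂ , refl , v₁⊆xs , v₂⊆ys = x ∷ v₁ , v₂ , refl , refl ∷ v₁⊆xs , v₂⊆ys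

AllPairs-++⁻ : ∀ {A : Set} {R : Rel A 0ℓ} xs {ys} → AllPairs R (xs ++ ys) →
               AllPairs R xs × AllPairs R ys × All (λ x → All (R x) ys) xs
AllPairs-++⁻ []       Rys = [] , Rys , []
AllPairs-++⁻ (x ∷ xs) (Rxxsys ∷ Rxsys) with AllPairs-++⁻ xs Rxsys | All.++⁻ xs Rxxsys
... | Rxs , Rys , Rxsys′ | Rxxs , Rxys = Rxxs ∷ Rxs , Rys , Rxys ∷ Rxsys′

decreasing⇒AllPairs : ∀ {v} → StrictlyDecreasing v → AllPairs _>_ v
decreasing⇒AllPairs = Linked⇒AllPairs (λ y<x z<y → <-trans z<y y<x)

decreasing-middle : ∀ v₁ {v₂ v₃} → StrictlyDecreasing (v₁ ++ v₂ ++ v₃) → StrictlyDecreasing v₂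
decreasing-middle v₁ {v₂} dec with AllPairs-++⁻ v₁ (decreasing⇒AllPairs dec)
... | _ , dec₂₃ , _ with AllPairs-++⁻ v₂ dec₂₃
... | dec₂ , _ , _ = AllPairs⇒Linked dec₂

-- Both junction conditions are convex in the letter being replaced.
splice-decreasing : ∀ v₁ {v₂ v₃ v₂′} → StrictlyDecreasing (v₁ ++ v₂ ++ v₃) →
                    StrictlyDecreasing v₂′ → (∀ {P} → Convex P → All P v₂ → All P v₂′) →
                    StrictlyDecreasing (v₁ ++ v₂′ ++ v₃)
splice-decreasing v₁ {v₂} {v₃} {v₂′} dec dec₂′ hull with AllPairs-++⁻ v₁ (decreasing⇒AllPairs dec)
... | dec₁ , dec₂₃ , v₁>v₂₃ with AllPairs-++⁻ v₂ dec₂₃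
... | _ , dec₃ , v₂>v₃ =
  AllPairs⇒Linked (AllPairs.++⁺ dec₁ (AllPairs.++⁺ pairs₂′ dec₃ v₂′>v₃) v₁>v₂′₃)
  where
    pairs₂′ : AllPairs _>_ v₂′
    pairs₂′ = decreasing⇒AllPairs dec₂′
    v₂′>v₃ : All (λ y → All (y >_) v₃) v₂′
    v₂′>v₃ = hull (upward-closed⇒convex (λ x≤y → All.map (λ z<x → <-≤-trans z<x x≤y))) v₂>v₃
    v₁>v₂′₃ : All (λ x → All (x >_) (v₂′ ++ v₃)) v₁
    v₁>v₂′₃ = All.map (λ x>v₂₃ → let x>v₂ , x>v₃ = All.++⁻ v₂ x>v₂₃ in
                All.++⁺ (hull (downward-closed⇒convex (λ x≤y y<z → ≤-<-trans x≤y y<z)) x>v₂) x>v₃)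
              v₁>v₂₃

splice-length : ∀ (v₁ v₃ : Word) {v₂ v₂′} → length v₂ ≤ length v₂′ →
                length (v₁ ++ v₂ ++ v₃) ≤ length (v₁ ++ v₂′ ++ v₃)
splice-length v₁ v₃ {v₂} {v₂′} le
  rewrite length-++ v₁ {v₂ ++ v₃} | length-++ v₁ {v₂′ ++ v₃}
        | length-++ v₂ {v₃} | length-++ v₂′ {v₃}
  = +-mono-≤ (≤-refl {length v₁}) (+-mono-≤ le ≤-refl)

splice-All : ∀ {P : Pred ℕ 0ℓ} v₁ {v₂ v₃ v₂′} → (All P v₂ → All P v₂′) →
             All P (v₁ ++ v₂ ++ v₃) → All P (v₁ ++ v₂′ ++ v₃)
splice-All v₁ {v₂} f Pv with All.++⁻ v₁ Pv
... | Pv₁ , Pv₂₃ with All.++⁻ v₂ Pv₂₃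
... | Pv₂ , Pv₃ = All.++⁺ Pv₁ (All.++⁺ (f Pv₂) Pv₃)

≼-cong : ∀ p s {x y} → x ≼ y → (p ++ x ++ s) ≼ (p ++ y ++ s)
≼-cong p s {x} {y} x≼y v⊆ dec with ⊆-++⁻ p v⊆
... | v₁ , _ , refl , v₁⊆p , v₂₃⊆ with ⊆-++⁻ x v₂₃⊆
... | v₂ , v₃ , refl , v₂⊆x , v₃⊆s = record
  { word        = v₁ ++ word r ++ v₃
  ; sublist     = Sublist.++⁺ v₁⊆p (Sublist.++⁺ (sublist r) v₃⊆s)
  ; decreasing  = splice-decreasing v₁ dec (decreasing r) (convex-hull r)
  ; longer      = splice-length v₁ v₃ (longer r)
  ; convex-hull = λ convex → splice-All v₁ (convex-hull r convex)
  }
  where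
    r : Replacement y v₂
    r = x≼y v₂⊆x (decreasing-middle v₁ dec)

Move⇒≼ : ∀ {u w} → Move u w → u ≼ w
Move⇒≼ (move p s (inj₁ b)) = ≼-cong p s (Basic⇒≼ b)
Move⇒≼ (move p s (inj₂ b)) = ≼-cong p s (Basic⇒≽ b)

Move-sym : ∀ {u w} → Move u w → Move w u
Move-sym (move p s (inj₁ b)) = move p s (inj₂ b)
Move-sym (move p s (inj₂ b)) = move p s (inj₁ b)

≡ᵢ⇒≼ : ∀ {u w} → u ≡ᵢ w → u ≼ w
≡ᵢ⇒≼ Star.ε        = ≼-refl
≡ᵢ⇒≼ (m Star.◅ ms) = ≼-trans (Move⇒≼ m) (≡ᵢ⇒≼ ms)

≡ᵢ-sym : ∀ {u w} → u ≡ᵢ w → w ≡ᵢ u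
≡ᵢ-sym = Star.reverse Move-sym

module _ {A : Set} {P : Pred A 0ℓ} (P? : Decidable P) where

  ⊆-filter⁻ : ∀ {v u} → v ⊆ filter P? u → v ⊆ u × All P v
  ⊆-filter⁻ {u = u} v⊆ = ⊆-trans v⊆ (filter-⊆ P? u) , All-resp-⊆ v⊆ (all-filter P? u)

  ⊆-filter⁺ : ∀ {v u} → v ⊆ u → All P v → v ⊆ filter P? u
  ⊆-filter⁺ {u = u} v⊆u Pv =
    subst (_⊆ filter P? u) (filter-all P? Pv) (filter⁺ P? P? (λ { refl → id }) v⊆u)

restrict-≼ : ∀ a b {u w} → u ≼ w → restrict a b u ≼ restrict a b w
restrict-≼ a b {w = w} u≼w {v} v⊆ dec with ⊆-filter⁻ _ v⊆
... | v⊆u , v∈[a,b] = record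
  { word        = word r
  ; sublist     = ⊆-filter⁺ _ (sublist r) (convex-hull r (interval-convex a b) v∈[a,b])
  ; decreasing  = decreasing r
  ; longer      = longer r
  ; convex-hull = convex-hull r
  }
  where
    r : Replacement w v
    r = u≼w v⊆u dec

IsLDS-≼ : ∀ {u w n} → u ≼ w → w ≼ u → IsLDS u n → IsLDS w n
IsLDS-≼ {w = w} {n} u≼w w≼u ((v , v⊆u , dec , refl) , maximal) =
  (word r , sublist r , decreasing r , ≤-antisym (bounded _ (sublist r) (decreasing r)) (longer r))
  , bounded
  where
    r : Replacement w v
    r = u≼w v⊆u dec
    bounded : ∀ x → x ⊆ w → StrictlyDecreasing x → length x ≤ n
    bounded x x⊆w dec′ = let r′ = w≼u x⊆w dec′ in
      ≤-trans (longer r′) (maximal (word r′) (sublist r′) (decreasing r′))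

lemma4p13 : (u w : Word) → Positive u → Positive w → u ≡ᵢ w → u ∼rd w
lemma4p13 u w _ _ u≡w a b n =
  IsLDS-≼ (restrict-≼ a b u≼w) (restrict-≼ a b w≼u) ,
  IsLDS-≼ (restrict-≼ a b w≼u) (restrict-≼ a b u≼w)
  where
    u≼w = ≡ᵢ⇒≼ u≡w
    w≼u = ≡ᵢ⇒≼ (≡ᵢ-sym u≡w)
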